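{- For an integer $r$, let $c(x)=\frac{1-\sqrt{1-4x}}{2x}$. Then in the Riordan group $$\left(\frac{1}{(1-rx)\sqrt{1-4x}},\, xc(x)\right)=\bigl(c(x),\,xc(x)\bigr)\cdot\left(\frac{1-x}{(1-2x)(1-rx+rx^2)},\,x\right).$$
   Context: A Riordan array is a pair $(g(x),f(x))$ of formal power series with $g(0)\neq0$, $f(0)=0$, $f'(0)\neq0$, identified with the matrix $(t_{n,k})$, $t_{n,k}=[x^n]g(x)f(x)^k$. The group product is $(g(x),f(x))\cdot(u(x),v(x))=(g(x)u(f(x)),\,v(f(x)))$, corresponding to matrix multiplication. -}

module Defs where

open import Data.Nat using (ℕ; zero; suc; _∸_)
open import Data.Integer using (ℤ; +_; _+_; _*_; _-_; -_)
open import Data.List using (List; []; _∷_)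
open import Data.Product using (_×_; _,_; proj₁; proj₂)
open import Relation.Binary.PropositionalEquality using (_≡_)

Series : Set
Series = ℕ → ℤ

sumTo : (ℕ → ℤ) → ℕ → ℤ
sumTo a zero    = a zero
sumTo a (suc n) = sumTo a n + a (suc n)

_⊛_ : Series → Series → Series
(f ⊛ g) n = sumTo (λ i → f i * g (n ∸ i)) n
infixl 7 _⊛_

oneS : Series
oneS zero    = + 1
oneS (suc _) = + 0

X : Series
X 1 = + 1
X _ = + 0

poly : List ℤ → Series
poly []       _       = + 0
poly (a ∷ as) zero    = a
poly (a ∷ as) (suc n) = poly as n

_^S_ : Series → ℕ → Series
f ^S zero  = oneS
f ^S suc k = f ⊛ (f ^S k)

-- composition u(f(x)), meaningful when f(0) = 0
_∘S_ : Series → Series → Series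
(u ∘S f) n = sumTo (λ k → u k * (f ^S k) n) n

_≈S_ : Series → Series → Set
f ≈S g = ∀ n → f n ≡ g n

Riordan : Set
Riordan = Series × Series

_·R_ : Riordan → Riordan → Riordan
(g , f) ·R (u , v) = (g ⊛ (u ∘S f) , v ∘S f)

_≈R_ : Riordan → Riordan → Set
a ≈R b = (proj₁ a ≈S proj₁ b) × (proj₂ a ≈S proj₂ b)

_⊖S_ : Series → Series → Series
(f ⊖S g) n = f n - g n
infixl 6 _⊖S_
infix 4 _≈S_ _≈R_
infixl 7 _·R_

{-# OPTIONS --safe #-}
module Submission where

-- Since y = x c(x) has no constant term, substituting y for x is a ring endomorphism of ℤ[[x]],
-- so the equation defining B becomes B(y) (1 - 2y) (1 - r y + r y²) = 1 - y.
-- From s² = 1 - 4x and 2 x c = 1 - s one gets s = 1 - 2y and c (1 - y) = 1, hence y - y² = x: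
-- thus 1 - r y + r y² = 1 - r x and c B(y) (1 - r x) s = c (1 - y) = 1. Multiplying by A,
-- where A (1 - r x) s = 1, gives A = c B(y), the first component of the product; the second
-- component is x(y) = y.

open import Defs
open import Algebra.Bundles using (CommutativeRing)
open import Algebra.Structures using (IsAbelianGroup)
import Algebra.Properties.CommutativeSemigroup as CommSemigroupProperties
open import Algebra.Solver.Ring.AlmostCommutativeRing
  using (AlmostCommutativeRing; fromCommutativeRing; _-Raw-AlmostCommutative⟶_)
open import Data.Integer using (ℤ; +_; -_; _+_; _*_; 0ℤ; 1ℤ; NonZero; +-*-rawRing)
import Data.Integer.Properties as ℤ
open import Data.List using (List; []; _∷_)
open import Data.Maybe using (Maybe; just; nothing)
open import Data.Nat using (ℕ; zero; suc; _∸_; _≤_; _<_; _≤′_; ≤′-reflexive; ≤′-step; z≤n; s≤s)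
open import Data.Nat.Induction using (<-rec)
open import Data.Nat.Properties
  using (≤-refl; m≤n⇒m≤1+n; n≤1+n; m∸n≤m; m∸[m∸n]≡n; ∸-monoʳ-<; <-≤-trans; ≤⇒≤′; ≤′⇒≤)
open import Data.Product using (_,_)
open import Level using (0ℓ)
open import Relation.Binary.PropositionalEquality
  using (_≡_; refl; sym; trans; cong; cong₂; module ≡-Reasoning)
import Relation.Binary.Reasoning.Setoid
open import Relation.Binary.Structures using (IsEquivalence)
open import Relation.Nullary using (yes; no)

open CommSemigroupProperties ℤ.+-commutativeSemigroup using (interchange)
open CommSemigroupProperties ℤ.*-commutativeSemigroup using (x∙yz≈y∙xz)

sumTo-cong : ∀ {a b : ℕ → ℤ} n → (∀ i → i ≤ n → a i ≡ b i) → sumTo a n ≡ sumTo b n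
sumTo-cong zero    a≡b = a≡b 0 z≤n
sumTo-cong (suc n) a≡b =
  cong₂ _+_ (sumTo-cong n (λ i i≤n → a≡b i (m≤n⇒m≤1+n i≤n))) (a≡b (suc n) ≤-refl)

sumTo-zero : ∀ {a : ℕ → ℤ} n → (∀ i → i ≤ n → a i ≡ 0ℤ) → sumTo a n ≡ 0ℤ
sumTo-zero zero    a≡0 = a≡0 0 z≤n
sumTo-zero (suc n) a≡0 =
  cong₂ _+_ (sumTo-zero n (λ i i≤n → a≡0 i (m≤n⇒m≤1+n i≤n))) (a≡0 (suc n) ≤-refl)

sumTo-+ : ∀ (a b : ℕ → ℤ) n → sumTo (λ i → a i + b i) n ≡ sumTo a n + sumTo b n
sumTo-+ a b zero    = refl
sumTo-+ a b (suc n) =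
  trans (cong (_+ (a (suc n) + b (suc n))) (sumTo-+ a b n)) (interchange (sumTo a n) (sumTo b n) (a (suc n)) (b (suc n)))

sumTo-*ˡ : ∀ k (a : ℕ → ℤ) n → sumTo (λ i → k * a i) n ≡ k * sumTo a n
sumTo-*ˡ k a zero    = refl
sumTo-*ˡ k a (suc n) =
  trans (cong (_+ k * a (suc n)) (sumTo-*ˡ k a n)) (sym (ℤ.*-distribˡ-+ k _ _))

sumTo-suc : ∀ (a : ℕ → ℤ) n → sumTo a (suc n) ≡ a 0 + sumTo (λ i → a (suc i)) n
sumTo-suc a zero    = refl
sumTo-suc a (suc n) = trans (cong (_+ a (suc (suc n))) (sumTo-suc a n)) (ℤ.+-assoc (a 0) (sumTo (λ i → a (suc i)) n) (a (suc (suc n))))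

sumTo-swap : ∀ (a : ℕ → ℕ → ℤ) m n →
  sumTo (λ i → sumTo (a i) m) n ≡ sumTo (λ j → sumTo (λ i → a i j) n) m
sumTo-swap a m zero    = refl
sumTo-swap a m (suc n) =
  trans (cong (_+ sumTo (a (suc n)) m) (sumTo-swap a m n)) (sym (sumTo-+ _ (a (suc n)) m))

sumTo-extend : ∀ (a : ℕ → ℤ) {m N} → m ≤ N → (∀ i → m < i → a i ≡ 0ℤ) → sumTo a m ≡ sumTo a N
sumTo-extend a {m} m≤N a≡0 = go (≤⇒≤′ m≤N)
  where
  go : ∀ {N} → m ≤′ N → sumTo a m ≡ sumTo a N
  go (≤′-reflexive refl) = refl
  go {suc N} (≤′-step m≤′N) = begin
    sumTo a m              ≡⟨ go m≤′N ⟩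
    sumTo a N              ≡⟨ ℤ.+-identityʳ (sumTo a N) ⟨
    sumTo a N + 0ℤ         ≡⟨ cong (_+_ (sumTo a N)) (a≡0 (suc N) (s≤s (≤′⇒≤ m≤′N))) ⟨
    sumTo a (suc N)        ∎
    where open ≡-Reasoning

sumTo-reverse : ∀ (a : ℕ → ℤ) n → sumTo (λ i → a (n ∸ i)) n ≡ sumTo a n
sumTo-reverse a zero    = refl
sumTo-reverse a (suc n) = begin
  sumTo (λ i → a (suc n ∸ i)) (suc n)    ≡⟨ sumTo-suc _ n ⟩
  a (suc n) + sumTo (λ i → a (n ∸ i)) n  ≡⟨ cong (_+_ (a (suc n))) (sumTo-reverse a n) ⟩
  a (suc n) + sumTo a n                  ≡⟨ ℤ.+-comm (a (suc n)) (sumTo a n) ⟩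
  sumTo a (suc n)                        ∎
  where open ≡-Reasoning

-- The ring of formal power series

infixl 6 _⊕_
infixr 8 _·_

_⊕_ : Series → Series → Series
(f ⊕ g) n = f n + g n

⊝_ : Series → Series
(⊝ f) n = - f n

0S : Series
0S _ = 0ℤ

_·_ : ℤ → Series → Series
(k · f) n = k * f n

const : ℤ → Series
const k = k · oneS

tail : Series → Series
tail f n = f (suc n)

tail-X : tail X ≈S oneS
tail-X zero    = refl
tail-X (suc n) = refl

⊛-cong : ∀ {f f′ g g′} → f ≈S f′ → g ≈S g′ → f ⊛ g ≈S f′ ⊛ g′
⊛-cong f≈f′ g≈g′ n = sumTo-cong n (λ i _ → cong₂ _*_ (f≈f′ i) (g≈g′ (n ∸ i)))

⊛-comm : ∀ f g → f ⊛ g ≈S g ⊛ f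
⊛-comm f g n = begin
  sumTo (λ i → f i * g (n ∸ i)) n              ≡⟨ sumTo-reverse (λ i → f i * g (n ∸ i)) n ⟨
  sumTo (λ i → f (n ∸ i) * g (n ∸ (n ∸ i))) n  ≡⟨ sumTo-cong n swap ⟩
  sumTo (λ i → g i * f (n ∸ i)) n              ∎
  where
  open ≡-Reasoning
  swap : ∀ i → i ≤ n → f (n ∸ i) * g (n ∸ (n ∸ i)) ≡ g i * f (n ∸ i)
  swap i i≤n rewrite m∸[m∸n]≡n i≤n = ℤ.*-comm (f (n ∸ i)) (g i)

⊛-identityˡ : ∀ f → oneS ⊛ f ≈S f
⊛-identityˡ f zero    = ℤ.*-identityˡ (f 0)
⊛-identityˡ f (suc n) = begin
  (oneS ⊛ f) (suc n)                                ≡⟨ sumTo-suc _ n ⟩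
  1ℤ * f (suc n) + sumTo (λ i → 0ℤ * f (n ∸ i)) n   ≡⟨ cong₂ _+_ (ℤ.*-identityˡ (f (suc n))) tail-terms ⟩
  f (suc n) + 0ℤ                                    ≡⟨ ℤ.+-identityʳ (f (suc n)) ⟩
  f (suc n)                                         ∎
  where
  open ≡-Reasoning
  tail-terms : sumTo (λ i → 0ℤ * f (n ∸ i)) n ≡ 0ℤ
  tail-terms = sumTo-zero n (λ i _ → ℤ.*-zeroˡ (f (n ∸ i)))

⊛-identityʳ : ∀ f → f ⊛ oneS ≈S f
⊛-identityʳ f n = trans (⊛-comm f oneS n) (⊛-identityˡ f n)

⊛-zeroʳ : ∀ f → f ⊛ 0S ≈S 0S
⊛-zeroʳ f n = sumTo-zero n (λ i _ → ℤ.*-zeroʳ (f i))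

⊛-distribʳ-⊕ : ∀ f g h → (f ⊕ g) ⊛ h ≈S f ⊛ h ⊕ g ⊛ h
⊛-distribʳ-⊕ f g h n =
  trans (sumTo-cong n (λ i _ → ℤ.*-distribʳ-+ (h (n ∸ i)) (f i) (g i))) (sumTo-+ _ _ n)

⊛-distribˡ-⊕ : ∀ f g h → h ⊛ (f ⊕ g) ≈S h ⊛ f ⊕ h ⊛ g
⊛-distribˡ-⊕ f g h n =
  trans (sumTo-cong n (λ i _ → ℤ.*-distribˡ-+ (h i) (f (n ∸ i)) (g (n ∸ i)))) (sumTo-+ _ _ n)

·-⊛-assoc : ∀ k f g → (k · f) ⊛ g ≈S k · (f ⊛ g)
·-⊛-assoc k f g n = trans (sumTo-cong n (λ i _ → ℤ.*-assoc k (f i) (g (n ∸ i)))) (sumTo-*ˡ k _ n)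

const-⊛ : ∀ k f → const k ⊛ f ≈S k · f
const-⊛ k f n = trans (·-⊛-assoc k oneS f n) (cong (k *_) (⊛-identityˡ f n))

X⊛-zero : ∀ f → (X ⊛ f) 0 ≡ 0ℤ
X⊛-zero f = ℤ.*-zeroˡ (f 0)

X⊛-suc : ∀ f n → (X ⊛ f) (suc n) ≡ f n
X⊛-suc f n = begin
  (X ⊛ f) (suc n)                   ≡⟨ sumTo-suc _ n ⟩
  X 0 * f (suc n) + (tail X ⊛ f) n  ≡⟨ cong₂ _+_ (ℤ.*-zeroˡ (f (suc n))) (⊛-cong {g = f} tail-X (λ _ → refl) n) ⟩
  0ℤ + (oneS ⊛ f) n                 ≡⟨ ℤ.+-identityˡ _ ⟩
  (oneS ⊛ f) n                      ≡⟨ ⊛-identityˡ f n ⟩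
  f n                               ∎
  where open ≡-Reasoning

⊛-cong-below : ∀ y {F G} → y 0 ≡ 0ℤ → ∀ n → (∀ m → m < n → F m ≡ G m) → (y ⊛ F) n ≡ (y ⊛ G) n
⊛-cong-below y {F} {G} y₀ n F≡G = sumTo-cong n term
  where
  term : ∀ i → i ≤ n → y i * F (n ∸ i) ≡ y i * G (n ∸ i)
  term zero    _     = trans (cong (_* F n) y₀) (trans (ℤ.*-zeroˡ (F n)) (sym (trans (cong (_* G n) y₀) (ℤ.*-zeroˡ (G n)))))
  term (suc i) 1+i≤n = cong (y (suc i) *_) (F≡G (n ∸ suc i) (∸-monoʳ-< (s≤s z≤n) 1+i≤n))

head+X⊛tail : ∀ f → f ≈S const (f 0) ⊕ X ⊛ tail f
head+X⊛tail f zero    = sym (trans (cong₂ _+_ (ℤ.*-identityʳ (f 0)) (X⊛-zero (tail f))) (ℤ.+-identityʳ (f 0)))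
head+X⊛tail f (suc n) = sym (trans (cong₂ _+_ (ℤ.*-zeroʳ (f 0)) (X⊛-suc (tail f) n)) (ℤ.+-identityˡ (f (suc n))))

X⊛-assoc : ∀ f g → (X ⊛ f) ⊛ g ≈S X ⊛ (f ⊛ g)
X⊛-assoc f g zero    = trans (cong (_* g 0) (X⊛-zero f)) (trans (ℤ.*-zeroˡ (g 0)) (sym (X⊛-zero (f ⊛ g))))
X⊛-assoc f g (suc n) = begin
  ((X ⊛ f) ⊛ g) (suc n)                                       ≡⟨ sumTo-suc _ n ⟩
  (X ⊛ f) 0 * g (suc n) + sumTo (λ i → (X ⊛ f) (suc i) * g (n ∸ i)) n
    ≡⟨ cong₂ _+_ (trans (cong (_* g (suc n)) (X⊛-zero f)) (ℤ.*-zeroˡ (g (suc n))))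
                 (sumTo-cong n (λ i _ → cong (_* g (n ∸ i)) (X⊛-suc f i))) ⟩
  0ℤ + (f ⊛ g) n                                              ≡⟨ ℤ.+-identityˡ _ ⟩
  (f ⊛ g) n                                                   ≡⟨ X⊛-suc (f ⊛ g) n ⟨
  (X ⊛ (f ⊛ g)) (suc n)                                       ∎
  where open ≡-Reasoning

⊛-unfoldˡ : ∀ f g → f ⊛ g ≈S f 0 · g ⊕ X ⊛ (tail f ⊛ g)
⊛-unfoldˡ f g n = begin
  (f ⊛ g) n                                    ≡⟨ ⊛-cong {g = g} (head+X⊛tail f) (λ _ → refl) n ⟩
  ((const (f 0) ⊕ X ⊛ tail f) ⊛ g) n           ≡⟨ ⊛-distribʳ-⊕ (const (f 0)) (X ⊛ tail f) g n ⟩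
  (const (f 0) ⊛ g) n + ((X ⊛ tail f) ⊛ g) n   ≡⟨ cong₂ _+_ (const-⊛ (f 0) g n) (X⊛-assoc (tail f) g n) ⟩
  f 0 * g n + (X ⊛ (tail f ⊛ g)) n             ∎
  where open ≡-Reasoning

⊛-assoc : ∀ f g h → (f ⊛ g) ⊛ h ≈S f ⊛ (g ⊛ h)
⊛-assoc f g h n = <-rec P step n f
  where
  P : ℕ → Set
  P n = ∀ f → ((f ⊛ g) ⊛ h) n ≡ (f ⊛ (g ⊛ h)) n

  step : ∀ n → (∀ {m} → m < n → P m) → P n
  step n ih f = begin
    ((f ⊛ g) ⊛ h) n
      ≡⟨ ⊛-cong {g = h} (⊛-unfoldˡ f g) (λ _ → refl) n ⟩
    ((f 0 · g ⊕ X ⊛ (tail f ⊛ g)) ⊛ h) n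
      ≡⟨ ⊛-distribʳ-⊕ (f 0 · g) (X ⊛ (tail f ⊛ g)) h n ⟩
    ((f 0 · g) ⊛ h) n + ((X ⊛ (tail f ⊛ g)) ⊛ h) n
      ≡⟨ cong₂ _+_ (·-⊛-assoc (f 0) g h n) (X⊛-assoc (tail f ⊛ g) h n) ⟩
    f 0 * (g ⊛ h) n + (X ⊛ ((tail f ⊛ g) ⊛ h)) n
      ≡⟨ cong (_+_ (f 0 * (g ⊛ h) n)) (⊛-cong-below X refl n (λ m m<n → ih m<n (tail f))) ⟩
    f 0 * (g ⊛ h) n + (X ⊛ (tail f ⊛ (g ⊛ h))) n
      ≡⟨ ⊛-unfoldˡ f (g ⊛ h) n ⟨
    (f ⊛ (g ⊛ h)) n ∎
    where open ≡-Reasoning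

-- Wrapping ≈S in a record lets Agda recover f and g from a proof of f ≋ g by unification,
-- which the ring solver and setoid reasoning depend on.
infix 4 _≋_
record _≋_ (f g : Series) : Set where
  constructor ≈S⇒≋
  field ≋⇒≈S : f ≈S g
open _≋_

≋-isEquivalence : IsEquivalence _≋_
≋-isEquivalence = record
  { refl  = ≈S⇒≋ (λ _ → refl)
  ; sym   = λ (≈S⇒≋ f≈g) → ≈S⇒≋ (λ n → sym (f≈g n))
  ; trans = λ (≈S⇒≋ f≈g) (≈S⇒≋ g≈h) → ≈S⇒≋ (λ n → trans (f≈g n) (g≈h n))
  }

⊕-isAbelianGroup : IsAbelianGroup _≋_ _⊕_ 0S ⊝_
⊕-isAbelianGroup = record
  { isGroup = record
    { isMonoid = record
      { isSemigroup = record
        { isMagma = record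
          { isEquivalence = ≋-isEquivalence
          ; ∙-cong = λ (≈S⇒≋ f≈f′) (≈S⇒≋ g≈g′) → ≈S⇒≋ (λ n → cong₂ _+_ (f≈f′ n) (g≈g′ n))
          }
        ; assoc = λ f g h → ≈S⇒≋ (λ n → ℤ.+-assoc (f n) (g n) (h n))
        }
      ; identity = (λ f → ≈S⇒≋ (λ n → ℤ.+-identityˡ (f n))) , (λ f → ≈S⇒≋ (λ n → ℤ.+-identityʳ (f n)))
      }
    ; inverse = (λ f → ≈S⇒≋ (λ n → ℤ.+-inverseˡ (f n))) , (λ f → ≈S⇒≋ (λ n → ℤ.+-inverseʳ (f n)))
    ; ⁻¹-cong = λ (≈S⇒≋ f≈g) → ≈S⇒≋ (λ n → cong -_ (f≈g n))
    }
  ; comm = λ f g → ≈S⇒≋ (λ n → ℤ.+-comm (f n) (g n))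
  }

Series-commutativeRing : CommutativeRing 0ℓ 0ℓ
Series-commutativeRing = record
  { Carrier = Series ; _≈_ = _≋_ ; _+_ = _⊕_ ; _*_ = _⊛_ ; -_ = ⊝_ ; 0# = 0S ; 1# = oneS
  ; isCommutativeRing = record
    { isRing = record
      { +-isAbelianGroup = ⊕-isAbelianGroup
      ; *-cong = λ (≈S⇒≋ f≈f′) (≈S⇒≋ g≈g′) → ≈S⇒≋ (⊛-cong f≈f′ g≈g′)
      ; *-assoc = λ f g h → ≈S⇒≋ (⊛-assoc f g h)
      ; *-identity = (λ f → ≈S⇒≋ (⊛-identityˡ f)) , (λ f → ≈S⇒≋ (⊛-identityʳ f))
      ; distrib = (λ h f g → ≈S⇒≋ (⊛-distribˡ-⊕ f g h)) , (λ h f g → ≈S⇒≋ (⊛-distribʳ-⊕ f g h))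
      }
    ; *-comm = λ f g → ≈S⇒≋ (⊛-comm f g)
    }
  }

module S = CommutativeRing Series-commutativeRing
module ≋-Reasoning = Relation.Binary.Reasoning.Setoid S.setoid

const-1 : const (+ 1) ≋ oneS
const-1 = ≈S⇒≋ (λ n → ℤ.*-identityˡ (oneS n))

const-neg : ∀ k → const (- k) ≋ ⊝ const k
const-neg k = ≈S⇒≋ (λ n → sym (ℤ.neg-distribˡ-* k (oneS n)))

X⊛-cancelˡ : ∀ {f g} → X ⊛ f ≋ X ⊛ g → f ≋ g
X⊛-cancelˡ {f} {g} (≈S⇒≋ Xf≈Xg) =
  ≈S⇒≋ (λ n → trans (sym (X⊛-suc f n)) (trans (Xf≈Xg (suc n)) (X⊛-suc g n)))

const-cancelˡ : ∀ k .{{_ : NonZero k}} {f g} → const k ⊛ f ≋ const k ⊛ g → f ≋ g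
const-cancelˡ k {f} {g} (≈S⇒≋ kf≈kg) = ≈S⇒≋ (λ n →
  ℤ.*-cancelˡ-≡ k (f n) (g n) (trans (sym (const-⊛ k f n)) (trans (kf≈kg n) (const-⊛ k g n))))

Series-almostCommutativeRing : AlmostCommutativeRing 0ℓ 0ℓ
Series-almostCommutativeRing = fromCommutativeRing Series-commutativeRing

const-morphism : +-*-rawRing -Raw-AlmostCommutative⟶ Series-almostCommutativeRing
const-morphism = record
  { ⟦_⟧    = const
  ; +-homo = λ a b → ≈S⇒≋ (λ n → ℤ.*-distribʳ-+ (oneS n) a b)
  ; *-homo = λ a b → ≈S⇒≋ (λ n → trans (ℤ.*-assoc a b (oneS n)) (sym (const-⊛ a (const b) n)))
  ; -‿homo = const-neg
  ; 0-homo = ≈S⇒≋ (λ n → ℤ.*-zeroˡ (oneS n))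
  ; 1-homo = const-1
  }

const-≟ : ∀ a b → Maybe (const a ≋ const b)
const-≟ a b with a ℤ.≟ b
... | yes refl = just S.refl
... | no _     = nothing

open import Algebra.Solver.Ring +-*-rawRing Series-almostCommutativeRing const-morphism const-≟
  using (solve; _:=_; _:+_; _:*_; _:-_; :-_; con)

horner : List ℤ → Series → Series
horner []       x = const 0ℤ
horner (a ∷ as) x = const a ⊕ x ⊛ horner as x

poly≈horner : ∀ as → poly as ≈S horner as X
poly≈horner []       n       = sym (ℤ.*-zeroˡ (oneS n))
poly≈horner (a ∷ as) zero    =
  sym (trans (cong₂ _+_ (ℤ.*-identityʳ a) (X⊛-zero (horner as X))) (ℤ.+-identityʳ a))
poly≈horner (a ∷ as) (suc n) =
  sym (trans (cong₂ _+_ (ℤ.*-zeroʳ a) (X⊛-suc (horner as X) n))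
             (trans (ℤ.+-identityˡ (horner as X n)) (sym (poly≈horner as n))))

-- Substitution of a series without constant term

module Substitution (y : Series) (y₀ : y 0 ≡ 0ℤ) where

  ^S-vanishes : ∀ k n → n < k → (y ^S k) n ≡ 0ℤ
  ^S-vanishes (suc k) n (s≤s n≤k) =
    trans (⊛-cong-below y y₀ n (λ m m<n → ^S-vanishes k m (<-≤-trans m<n n≤k))) (⊛-zeroʳ y n)

  ∘S-truncate : ∀ u {n N} → n ≤ N → (u ∘S y) n ≡ sumTo (λ k → u k * (y ^S k) n) N
  ∘S-truncate u {n} n≤N =
    sumTo-extend _ n≤N (λ k n<k → trans (cong (u k *_) (^S-vanishes k n n<k)) (ℤ.*-zeroʳ (u k)))

  ∘S-cong : ∀ {u v} → u ≈S v → u ∘S y ≈S v ∘S y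
  ∘S-cong u≈v n = sumTo-cong n (λ k _ → cong (_* (y ^S k) n) (u≈v k))

  ∘S-⊕ : ∀ u v → (u ⊕ v) ∘S y ≈S u ∘S y ⊕ v ∘S y
  ∘S-⊕ u v n = trans (sumTo-cong n (λ k _ → ℤ.*-distribʳ-+ ((y ^S k) n) (u k) (v k))) (sumTo-+ _ _ n)

  ∘S-· : ∀ a u → (a · u) ∘S y ≈S a · (u ∘S y)
  ∘S-· a u n = trans (sumTo-cong n (λ k _ → ℤ.*-assoc a (u k) ((y ^S k) n))) (sumTo-*ˡ a _ n)

  ∘S-oneS : oneS ∘S y ≈S oneS
  ∘S-oneS zero    = refl
  ∘S-oneS (suc n) =
    trans (sumTo-suc _ n) (cong (_+_ (1ℤ * 0ℤ)) (sumTo-zero n (λ k _ → ℤ.*-zeroˡ ((y ^S suc k) (suc n)))))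

  ∘S-const : ∀ a → const a ∘S y ≈S const a
  ∘S-const a n = trans (∘S-· a oneS n) (cong (a *_) (∘S-oneS n))

  ∘S-X⊛ : ∀ u → (X ⊛ u) ∘S y ≈S y ⊛ (u ∘S y)
  ∘S-X⊛ u n = begin
    ((X ⊛ u) ∘S y) n
      ≡⟨ ∘S-truncate (X ⊛ u) (n≤1+n n) ⟩
    sumTo (λ k → (X ⊛ u) k * (y ^S k) n) (suc n)
      ≡⟨ sumTo-suc _ n ⟩
    (X ⊛ u) 0 * oneS n + sumTo (λ k → (X ⊛ u) (suc k) * (y ⊛ y ^S k) n) n
      ≡⟨ cong₂ _+_ (trans (cong (_* oneS n) (X⊛-zero u)) (ℤ.*-zeroˡ (oneS n)))
                   (sumTo-cong n (λ k _ → cong (_* (y ⊛ y ^S k) n) (X⊛-suc u k))) ⟩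
    0ℤ + sumTo (λ k → u k * (y ⊛ y ^S k) n) n
      ≡⟨ ℤ.+-identityˡ _ ⟩
    sumTo (λ k → u k * sumTo (λ i → y i * (y ^S k) (n ∸ i)) n) n
      ≡⟨ sumTo-cong n (λ k _ → sym (sumTo-*ˡ (u k) _ n)) ⟩
    sumTo (λ k → sumTo (λ i → u k * (y i * (y ^S k) (n ∸ i))) n) n
      ≡⟨ sumTo-swap _ n n ⟩
    sumTo (λ i → sumTo (λ k → u k * (y i * (y ^S k) (n ∸ i))) n) n
      ≡⟨ sumTo-cong n (λ i _ → factor i) ⟩
    (y ⊛ (u ∘S y)) n ∎
    where
    open ≡-Reasoning
    factor : ∀ i → sumTo (λ k → u k * (y i * (y ^S k) (n ∸ i))) n ≡ y i * (u ∘S y) (n ∸ i)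
    factor i = begin
      sumTo (λ k → u k * (y i * (y ^S k) (n ∸ i))) n  ≡⟨ sumTo-cong n (λ k _ → x∙yz≈y∙xz (u k) (y i) _) ⟩
      sumTo (λ k → y i * (u k * (y ^S k) (n ∸ i))) n  ≡⟨ sumTo-*ˡ (y i) _ n ⟩
      y i * sumTo (λ k → u k * (y ^S k) (n ∸ i)) n    ≡⟨ cong (y i *_) (∘S-truncate u (m∸n≤m n i)) ⟨
      y i * (u ∘S y) (n ∸ i)                          ∎

  ∘S-X : X ∘S y ≈S y
  ∘S-X n = begin
    (X ∘S y) n               ≡⟨ ∘S-cong (λ m → sym (⊛-identityʳ X m)) n ⟩
    ((X ⊛ oneS) ∘S y) n      ≡⟨ ∘S-X⊛ oneS n ⟩
    (y ⊛ (oneS ∘S y)) n      ≡⟨ ⊛-cong {f = y} (λ _ → refl) ∘S-oneS n ⟩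
    (y ⊛ oneS) n             ≡⟨ ⊛-identityʳ y n ⟩
    y n                      ∎
    where open ≡-Reasoning

  ∘S-horner : ∀ as → horner as X ∘S y ≈S horner as y
  ∘S-horner []       = ∘S-const 0ℤ
  ∘S-horner (a ∷ as) n = begin
    ((const a ⊕ X ⊛ horner as X) ∘S y) n            ≡⟨ ∘S-⊕ (const a) (X ⊛ horner as X) n ⟩
    (const a ∘S y) n + ((X ⊛ horner as X) ∘S y) n   ≡⟨ cong₂ _+_ (∘S-const a n) (∘S-X⊛ (horner as X) n) ⟩
    const a n + (y ⊛ (horner as X ∘S y)) n          ≡⟨ cong (_+_ (const a n)) (⊛-cong {f = y} (λ _ → refl) (∘S-horner as) n) ⟩
    const a n + (y ⊛ horner as y) n                 ∎
    where open ≡-Reasoning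

  ∘S-poly : ∀ as → poly as ∘S y ≋ horner as y
  ∘S-poly as = ≈S⇒≋ (λ n → trans (∘S-cong (poly≈horner as) n) (∘S-horner as n))

  ∘S-affine : ∀ a u v → (a · u ⊕ X ⊛ v) ∘S y ≋ a · (u ∘S y) ⊕ y ⊛ (v ∘S y)
  ∘S-affine a u v = ≈S⇒≋ (λ n → trans (∘S-⊕ (a · u) (X ⊛ v) n) (cong₂ _+_ (∘S-· a u n) (∘S-X⊛ v n)))

  ∘S-head+y⊛tail : ∀ u → u ∘S y ≋ const (u 0) ⊕ y ⊛ (tail u ∘S y)
  ∘S-head+y⊛tail u = begin
    u ∘S y                                      ≈⟨ ≈S⇒≋ (∘S-cong (head+X⊛tail u)) ⟩
    (u 0 · oneS ⊕ X ⊛ tail u) ∘S y              ≈⟨ ∘S-affine (u 0) oneS (tail u) ⟩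
    u 0 · (oneS ∘S y) ⊕ y ⊛ (tail u ∘S y)       ≈⟨ S.+-congʳ (≈S⇒≋ (λ n → cong (u 0 *_) (∘S-oneS n))) ⟩
    const (u 0) ⊕ y ⊛ (tail u ∘S y)             ∎
    where open ≋-Reasoning

  -- Strong induction on the coefficient, writing u = u(0) + x · tail u: because y(0) = 0,
  -- the remaining y ⊛ … term at n only involves lower coefficients.
  ∘S-⊛ : ∀ u v → (u ⊛ v) ∘S y ≈S (u ∘S y) ⊛ (v ∘S y)
  ∘S-⊛ u v n = <-rec P step n u
    where
    P : ℕ → Set
    P n = ∀ u → ((u ⊛ v) ∘S y) n ≡ ((u ∘S y) ⊛ (v ∘S y)) n

    unfold-product : ∀ u → (u ∘S y) ⊛ (v ∘S y) ≋ u 0 · (v ∘S y) ⊕ y ⊛ ((tail u ∘S y) ⊛ (v ∘S y))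
    unfold-product u = begin
      (u ∘S y) ⊛ (v ∘S y)                                 ≈⟨ S.*-congʳ {v ∘S y} (∘S-head+y⊛tail u) ⟩
      (const (u 0) ⊕ y ⊛ (tail u ∘S y)) ⊛ (v ∘S y)        ≈⟨ S.distribʳ (v ∘S y) (const (u 0)) _ ⟩
      const (u 0) ⊛ (v ∘S y) ⊕ y ⊛ (tail u ∘S y) ⊛ (v ∘S y)
        ≈⟨ S.+-cong (≈S⇒≋ (const-⊛ (u 0) (v ∘S y))) (S.*-assoc y (tail u ∘S y) (v ∘S y)) ⟩
      u 0 · (v ∘S y) ⊕ y ⊛ ((tail u ∘S y) ⊛ (v ∘S y))     ∎
      where open ≋-Reasoning

    step : ∀ n → (∀ {m} → m < n → P m) → P n
    step n ih u = begin
      ((u ⊛ v) ∘S y) n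
        ≡⟨ ∘S-cong (⊛-unfoldˡ u v) n ⟩
      ((u 0 · v ⊕ X ⊛ (tail u ⊛ v)) ∘S y) n
        ≡⟨ ≋⇒≈S (∘S-affine (u 0) v (tail u ⊛ v)) n ⟩
      u 0 * (v ∘S y) n + (y ⊛ ((tail u ⊛ v) ∘S y)) n
        ≡⟨ cong (_+_ (u 0 * (v ∘S y) n)) (⊛-cong-below y y₀ n (λ m m<n → ih m<n (tail u))) ⟩
      u 0 * (v ∘S y) n + (y ⊛ ((tail u ∘S y) ⊛ (v ∘S y))) n
        ≡⟨ ≋⇒≈S (unfold-product u) n ⟨
      ((u ∘S y) ⊛ (v ∘S y)) n ∎
      where open ≡-Reasoning

  ∘S-equation : ∀ u p q t → u ⊛ (poly p ⊛ poly q) ≈S poly t →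
                (u ∘S y) ⊛ (horner p y ⊛ horner q y) ≋ horner t y
  ∘S-equation u p q t equation = begin
    (u ∘S y) ⊛ (horner p y ⊛ horner q y)        ≈⟨ S.*-congˡ {u ∘S y} (S.*-cong (∘S-poly p) (∘S-poly q)) ⟨
    (u ∘S y) ⊛ (poly p ∘S y ⊛ poly q ∘S y)      ≈⟨ S.*-congˡ {u ∘S y} (≈S⇒≋ (∘S-⊛ (poly p) (poly q))) ⟨
    (u ∘S y) ⊛ ((poly p ⊛ poly q) ∘S y)         ≈⟨ ≈S⇒≋ (∘S-⊛ u (poly p ⊛ poly q)) ⟨
    (u ⊛ (poly p ⊛ poly q)) ∘S y                ≈⟨ ≈S⇒≋ (∘S-cong equation) ⟩
    poly t ∘S y                                 ≈⟨ ∘S-poly t ⟩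
    horner t y                                  ∎
    where open ≋-Reasoning

-- The Catalan generating function

open ≋-Reasoning

sqrt≋1-2xc : ∀ s c → poly (+ 0 ∷ + 2 ∷ []) ⊛ c ≈S poly (+ 1 ∷ []) ⊖S s →
             s ≋ const (+ 1) ⊖S const (+ 2) ⊛ (X ⊛ c)
sqrt≋1-2xc s c 2xc≈1-s = begin
  s
    ≈⟨ solve 2 (λ p s → s := p :- (p :- s)) S.refl (poly (+ 1 ∷ [])) s ⟩
  poly (+ 1 ∷ []) ⊖S (poly (+ 1 ∷ []) ⊖S s)
    ≈⟨ S.+-congˡ {poly (+ 1 ∷ [])} (S.-‿cong (≈S⇒≋ 2xc≈1-s)) ⟨
  poly (+ 1 ∷ []) ⊖S poly (+ 0 ∷ + 2 ∷ []) ⊛ c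
    ≈⟨ S.+-cong (≈S⇒≋ (poly≈horner (+ 1 ∷ [])))
                (S.-‿cong (S.*-congʳ {c} (≈S⇒≋ (poly≈horner (+ 0 ∷ + 2 ∷ []))))) ⟩
  horner (+ 1 ∷ []) X ⊖S horner (+ 0 ∷ + 2 ∷ []) X ⊛ c
    ≈⟨ solve 2 (λ x c → (con (+ 1) :+ x :* con 0ℤ) :- (con 0ℤ :+ x :* (con (+ 2) :+ x :* con 0ℤ)) :* c
                        := con (+ 1) :- con (+ 2) :* (x :* c)) S.refl X c ⟩
  const (+ 1) ⊖S const (+ 2) ⊛ (X ⊛ c) ∎

catalan-equation : ∀ s c → s ⊛ s ≈S poly (+ 1 ∷ - (+ 4) ∷ []) →
                   s ≋ const (+ 1) ⊖S const (+ 2) ⊛ (X ⊛ c) →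
                   c ⊛ (const (+ 1) ⊖S X ⊛ c) ≋ const (+ 1)
catalan-equation s c s²≈1-4x s≋1-2xc = X⊛-cancelˡ (const-cancelˡ (+ 4) (begin
  const (+ 4) ⊛ (X ⊛ (c ⊛ (const (+ 1) ⊖S X ⊛ c)))
    ≈⟨ solve 2 (λ x c → con (+ 4) :* (x :* (c :* (con (+ 1) :- x :* c)))
                        := con (+ 1) :- (con (+ 1) :- con (+ 2) :* (x :* c)) :* (con (+ 1) :- con (+ 2) :* (x :* c)))
               S.refl X c ⟩
  const (+ 1) ⊖S (const (+ 1) ⊖S const (+ 2) ⊛ (X ⊛ c)) ⊛ (const (+ 1) ⊖S const (+ 2) ⊛ (X ⊛ c))
    ≈⟨ S.+-congˡ {const (+ 1)} (S.-‿cong (S.*-cong s≋1-2xc s≋1-2xc)) ⟨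
  const (+ 1) ⊖S s ⊛ s
    ≈⟨ S.+-congˡ {const (+ 1)} (S.-‿cong (S.trans (≈S⇒≋ s²≈1-4x) (≈S⇒≋ (poly≈horner (+ 1 ∷ - (+ 4) ∷ []))))) ⟩
  const (+ 1) ⊖S horner (+ 1 ∷ - (+ 4) ∷ []) X
    ≈⟨ solve 1 (λ x → con (+ 1) :- (con (+ 1) :+ x :* (con (- (+ 4)) :+ x :* con 0ℤ))
                      := con (+ 4) :* (x :* con (+ 1))) S.refl X ⟩
  const (+ 4) ⊛ (X ⊛ const (+ 1)) ∎))

first-column : ∀ r x s c a b →
  c ⊛ (const (+ 1) ⊖S x ⊛ c) ≋ const (+ 1) →
  s ≋ const (+ 1) ⊖S const (+ 2) ⊛ (x ⊛ c) →
  a ⊛ (horner (+ 1 ∷ - r ∷ []) x ⊛ s) ≋ const (+ 1) →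
  b ⊛ (horner (+ 1 ∷ - (+ 2) ∷ []) (x ⊛ c) ⊛ horner (+ 1 ∷ - r ∷ r ∷ []) (x ⊛ c))
    ≋ horner (+ 1 ∷ - (+ 1) ∷ []) (x ⊛ c) →
  a ≋ c ⊛ b
first-column r x s c a b c[1-y]≋1 s≋1-2y a-inverse b-equation = begin
  a                                ≈⟨ solve 1 (λ a → a := a :* con (+ 1)) S.refl a ⟩
  a ⊛ const (+ 1)                  ≈⟨ S.*-congˡ {a} c⊛b-inverse ⟨
  a ⊛ (c ⊛ (b ⊛ (L ⊛ s)))
    ≈⟨ solve 5 (λ a c b l s → a :* (c :* (b :* (l :* s))) := (a :* (l :* s)) :* (c :* b)) S.refl a c b L s ⟩
  (a ⊛ (L ⊛ s)) ⊛ (c ⊛ b)          ≈⟨ S.*-congʳ {c ⊛ b} a-inverse ⟩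
  const (+ 1) ⊛ (c ⊛ b)            ≈⟨ solve 2 (λ c b → con (+ 1) :* (c :* b) := c :* b) S.refl c b ⟩
  c ⊛ b                            ∎
  where
  y ρ L : Series
  y = x ⊛ c
  -- const r enters the solver as a variable ρ: it only normalises numeral coefficients.
  ρ = const r
  L = horner (+ 1 ∷ - r ∷ []) x

  y-y²≋x : y ⊖S y ⊛ y ≋ x
  y-y²≋x = begin
    y ⊖S y ⊛ y
      ≈⟨ solve 2 (λ x c → x :* c :- (x :* c) :* (x :* c) := x :* (c :* (con (+ 1) :- x :* c))) S.refl x c ⟩
    x ⊛ (c ⊛ (const (+ 1) ⊖S y))   ≈⟨ S.*-congˡ {x} c[1-y]≋1 ⟩
    x ⊛ const (+ 1)                ≈⟨ solve 1 (λ x → x :* con (+ 1) := x) S.refl x ⟩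
    x                              ∎

  L≋1-ρx : L ≋ const (+ 1) ⊖S ρ ⊛ x
  L≋1-ρx = begin
    const (+ 1) ⊕ x ⊛ (const (- r) ⊕ x ⊛ const 0ℤ)
      ≈⟨ S.+-congˡ {const (+ 1)} (S.*-congˡ {x} (S.+-congʳ {x ⊛ const 0ℤ} (const-neg r))) ⟩
    const (+ 1) ⊕ x ⊛ (⊝ ρ ⊕ x ⊛ const 0ℤ)
      ≈⟨ solve 2 (λ x ρ → con (+ 1) :+ x :* (:- ρ :+ x :* con 0ℤ) := con (+ 1) :- ρ :* x) S.refl x ρ ⟩
    const (+ 1) ⊖S ρ ⊛ x ∎

  quadratic≋1-ρx : horner (+ 1 ∷ - r ∷ r ∷ []) y ≋ const (+ 1) ⊖S ρ ⊛ x
  quadratic≋1-ρx = begin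
    const (+ 1) ⊕ y ⊛ (const (- r) ⊕ y ⊛ (ρ ⊕ y ⊛ const 0ℤ))
      ≈⟨ S.+-congˡ {const (+ 1)} (S.*-congˡ {y} (S.+-congʳ {y ⊛ (ρ ⊕ y ⊛ const 0ℤ)} (const-neg r))) ⟩
    const (+ 1) ⊕ y ⊛ (⊝ ρ ⊕ y ⊛ (ρ ⊕ y ⊛ const 0ℤ))
      ≈⟨ solve 2 (λ y ρ → con (+ 1) :+ y :* (:- ρ :+ y :* (ρ :+ y :* con 0ℤ)) := con (+ 1) :- ρ :* (y :- y :* y))
               S.refl y ρ ⟩
    const (+ 1) ⊖S ρ ⊛ (y ⊖S y ⊛ y)
      ≈⟨ S.+-congˡ {const (+ 1)} (S.-‿cong (S.*-congˡ {ρ} y-y²≋x)) ⟩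
    const (+ 1) ⊖S ρ ⊛ x ∎

  c⊛b-inverse : c ⊛ (b ⊛ (L ⊛ s)) ≋ const (+ 1)
  c⊛b-inverse = begin
    c ⊛ (b ⊛ (L ⊛ s))
      ≈⟨ S.*-congˡ {c} (S.*-congˡ {b} (S.*-cong L≋1-ρx s≋1-2y)) ⟩
    c ⊛ (b ⊛ ((const (+ 1) ⊖S ρ ⊛ x) ⊛ (const (+ 1) ⊖S const (+ 2) ⊛ y)))
      ≈⟨ solve 4 (λ c b q y → c :* (b :* (q :* (con (+ 1) :- con (+ 2) :* y)))
                            := c :* (b :* ((con (+ 1) :+ y :* (con (- (+ 2)) :+ y :* con 0ℤ)) :* q)))
               S.refl c b (const (+ 1) ⊖S ρ ⊛ x) y ⟩
    c ⊛ (b ⊛ (horner (+ 1 ∷ - (+ 2) ∷ []) y ⊛ (const (+ 1) ⊖S ρ ⊛ x)))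
      ≈⟨ S.*-congˡ {c} (S.*-congˡ {b} (S.*-congˡ {horner (+ 1 ∷ - (+ 2) ∷ []) y} quadratic≋1-ρx)) ⟨
    c ⊛ (b ⊛ (horner (+ 1 ∷ - (+ 2) ∷ []) y ⊛ horner (+ 1 ∷ - r ∷ r ∷ []) y))
      ≈⟨ S.*-congˡ {c} b-equation ⟩
    c ⊛ horner (+ 1 ∷ - (+ 1) ∷ []) y
      ≈⟨ solve 2 (λ c y → c :* (con (+ 1) :+ y :* (con (- (+ 1)) :+ y :* con 0ℤ)) := c :* (con (+ 1) :- y))
               S.refl c y ⟩
    c ⊛ (const (+ 1) ⊖S y)
      ≈⟨ c[1-y]≋1 ⟩
    const (+ 1) ∎

mainTheorem4 : (r : ℤ) (s c A B : Series) →
    s 0 ≡ + 1 → (s ⊛ s) ≈S poly (+ 1 ∷ - (+ 4) ∷ []) →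
    (poly (+ 0 ∷ + 2 ∷ []) ⊛ c) ≈S poly (+ 1 ∷ []) ⊖S s →
    (A ⊛ (poly (+ 1 ∷ - r ∷ []) ⊛ s)) ≈S oneS →
    (B ⊛ (poly (+ 1 ∷ - (+ 2) ∷ []) ⊛ poly (+ 1 ∷ - r ∷ r ∷ []))) ≈S poly (+ 1 ∷ - (+ 1) ∷ []) →
    (A , X ⊛ c) ≈R ((c , X ⊛ c) ·R (B , X))
mainTheorem4 r s c A B _ s²≈1-4x 2xc≈1-s A-equation B-equation =
  ≋⇒≈S (first-column r X s c A (B ∘S y) c[1-y]≋1 s≋1-2y A-inverse B∘y-equation) , λ n → sym (∘S-X n)
  where
  y : Series
  y = X ⊛ c
  open Substitution y (X⊛-zero c)

  s≋1-2y : s ≋ const (+ 1) ⊖S const (+ 2) ⊛ y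
  s≋1-2y = sqrt≋1-2xc s c 2xc≈1-s

  c[1-y]≋1 : c ⊛ (const (+ 1) ⊖S y) ≋ const (+ 1)
  c[1-y]≋1 = catalan-equation s c s²≈1-4x s≋1-2y

  B∘y-equation : (B ∘S y) ⊛ (horner (+ 1 ∷ - (+ 2) ∷ []) y ⊛ horner (+ 1 ∷ - r ∷ r ∷ []) y)
                   ≋ horner (+ 1 ∷ - (+ 1) ∷ []) y
  B∘y-equation = ∘S-equation B (+ 1 ∷ - (+ 2) ∷ []) (+ 1 ∷ - r ∷ r ∷ []) (+ 1 ∷ - (+ 1) ∷ []) B-equation

  A-inverse : A ⊛ (horner (+ 1 ∷ - r ∷ []) X ⊛ s) ≋ const (+ 1)
  A-inverse = begin
    A ⊛ (horner (+ 1 ∷ - r ∷ []) X ⊛ s)  ≈⟨ S.*-congˡ {A} (S.*-congʳ {s} (≈S⇒≋ (poly≈horner (+ 1 ∷ - r ∷ [])))) ⟨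
    A ⊛ (poly (+ 1 ∷ - r ∷ []) ⊛ s)      ≈⟨ ≈S⇒≋ A-equation ⟩
    oneS                                 ≈⟨ const-1 ⟨
    const (+ 1)                          ∎
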